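{- Let $G(V,E)$ be a graph and let $w=P_1P_2\cdots P_k$ be a permutational $1$-$11$-representation of $G$, where each $P_j$ is a permutation of $V$. If $P_i=P_{i+1}$ for some $i$ (so that $w$ contains the square $P_iP_i$), then the word obtained from $w$ by deleting one of these two occurrences of $P_i$ is also a $1$-$11$-representation of $G$.
   Context: For a word $w$ and letters $x,y$, $w_{\{x,y\}}$ denotes the word obtained from $w$ by deleting all letters other than $x$ and $y$. A word $w\in V^{+}$ is a $1$-$11$-representation of a graph $G(V,E)$ if for all distinct $x,y\in V$: $x,y$ are adjacent in $G$ iff $w_{\{x,y\}}$ contains at most one factor of the form $xx$ or $yy$ in total (equivalently, non-adjacent iff $w_{\{x,y\}}$ contains at least two occurrences of $xx$, or at least two of $yy$, or at least one of each). A $1$-$11$-representation is permutational if it is a concatenation of permutations of $V$ (words in which each vertex of $V$ occurs exactly once). -}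

module Defs where

open import Data.Nat using (ℕ; zero; suc; _+_; _≤_)
open import Data.Fin using (Fin; _≟_)
open import Data.List using (List; []; _∷_; concat; filter)
open import Data.List.Relation.Unary.All using (All)
open import Relation.Binary.PropositionalEquality using (_≡_)
open import Relation.Nullary using (¬_; yes; no)
open import Relation.Nullary.Decidable using (_⊎-dec_)
open import Data.Product using (_×_)
open import Data.Empty using (⊥)
open import Data.Unit using (⊤)
open import Level using (0ℓ)
open import Function.Bundles using (_⇔_)

record Graph (n : ℕ) : Set₁ where
  field
    E     : Fin n → Fin n → Set
    sym   : ∀ {x y} → E x y → E y x
    irrfl : ∀ {x} → ¬ E x x
open Graph public

Word : ℕ → Set
Word n = List (Fin n)

occ : ∀ {n} → Fin n → Word n → ℕ
occ x [] = 0
occ x (y ∷ w) with x ≟ y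
... | yes _ = suc (occ x w)
... | no _  = occ x w

restrict : ∀ {n} → Fin n → Fin n → Word n → Word n
restrict x y w = filter (λ z → (z ≟ x) ⊎-dec (z ≟ y)) w

-- number of (possibly overlapping) factors  a a  in w
countSq : ∀ {n} → Fin n → Word n → ℕ
countSq a [] = 0
countSq a (b ∷ w) = go b w
  where
  go : _ → Word _ → ℕ
  go b [] = 0
  go b (c ∷ w) with a ≟ b | a ≟ c
  ... | yes _ | yes _ = suc (go c w)
  ... | _     | _     = go c w

squareCount : ∀ {n} → Fin n → Fin n → Word n → ℕ
squareCount x y w = countSq x (restrict x y w) + countSq y (restrict x y w)

NonEmpty : ∀ {n} → Word n → Set
NonEmpty [] = ⊥
NonEmpty (_ ∷ _) = ⊤

Is1-11-Rep : ∀ {n} → Graph n → Word n → Set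
Is1-11-Rep {n} G w =
  NonEmpty w × (∀ (x y : Fin n) → ¬ x ≡ y → (E G x y ⇔ (squareCount x y w ≤ 1)))

IsPerm : ∀ {n} → Word n → Set
IsPerm {n} P = ∀ (x : Fin n) → occ x P ≡ 1

-- Restricted to two distinct letters x, y, a permutation P becomes xy or yx, so
-- w_{x,y} changes from u p q p q v to u p q v with p ≠ q.  Deleting the factor q p
-- that follows an occurrence of p creates and destroys no factor aa when p ≠ q,
-- hence the number of factors xx and yy in w_{x,y}, and with it adjacency, is
-- unchanged for every pair of vertices.
module Submission where

open import Defs hiding (sym)
open import Data.Nat using (ℕ; suc; _+_; _≤_)
open import Data.Nat.Properties using (suc-injective)
open import Data.Fin using (Fin; _≟_)
open import Data.List using (List; []; _∷_; _++_; concat)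
open import Data.List.Properties using (concat-++; filter-++; filter-accept; filter-reject; filter-≐)
open import Data.List.Relation.Unary.All using (All)
open import Data.Product using (_×_; _,_; ∃₂)
open import Data.Sum using (_⊎_; inj₁; inj₂; swap; [_,_]′)
open import Data.Empty using (⊥-elim)
open import Data.Unit using (tt)
open import Function using (_∘_)
open import Function.Bundles using (mk⇔; Equivalence)
open import Relation.Nullary using (¬_; yes; no; _⊎-dec_)
open import Relation.Binary.PropositionalEquality
  using (_≡_; _≢_; refl; sym; trans; cong; cong₂; subst)
open Relation.Binary.PropositionalEquality.≡-Reasoning

module _ {n : ℕ} where

  restrict-∷-accept : ∀ {x y z : Fin n} w → z ≡ x ⊎ z ≡ y →
                      restrict x y (z ∷ w) ≡ z ∷ restrict x y w
  restrict-∷-accept {x} {y} w = filter-accept (λ z → (z ≟ x) ⊎-dec (z ≟ y))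

  restrict-∷-reject : ∀ {x y z : Fin n} w → x ≢ z → y ≢ z →
                      restrict x y (z ∷ w) ≡ restrict x y w
  restrict-∷-reject {x} {y} w x≢z y≢z =
    filter-reject (λ z → (z ≟ x) ⊎-dec (z ≟ y)) [ x≢z ∘ sym , y≢z ∘ sym ]′

  restrict-comm : ∀ (x y : Fin n) w → restrict x y w ≡ restrict y x w
  restrict-comm x y = filter-≐ (λ z → (z ≟ x) ⊎-dec (z ≟ y)) (λ z → (z ≟ y) ⊎-dec (z ≟ x))
                               (swap , swap)

  restrict-++ : ∀ (x y : Fin n) u v → restrict x y (u ++ v) ≡ restrict x y u ++ restrict x y v
  restrict-++ x y = filter-++ (λ z → (z ≟ x) ⊎-dec (z ≟ y))

  restrict-absent : ∀ (x y : Fin n) w → occ x w ≡ 0 → occ y w ≡ 0 → restrict x y w ≡ []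
  restrict-absent x y []      _  _  = refl
  restrict-absent x y (z ∷ w) ox oy with x ≟ z | y ≟ z
  ... | yes refl | _        with () ← ox
  ... | no _     | yes refl with () ← oy
  ... | no x≢z   | no y≢z   = trans (restrict-∷-reject w x≢z y≢z) (restrict-absent x y w ox oy)

  restrict-single : ∀ (x y : Fin n) w → occ x w ≡ 1 → occ y w ≡ 0 → restrict x y w ≡ x ∷ []
  restrict-single x y []      () _
  restrict-single x y (z ∷ w) ox oy with x ≟ z | y ≟ z
  ... | _        | yes refl with () ← oy
  ... | yes refl | no _     = trans (restrict-∷-accept w (inj₁ refl))
    (cong (x ∷_) (restrict-absent x y w (suc-injective ox) oy))
  ... | no x≢z   | no y≢z   = trans (restrict-∷-reject w x≢z y≢z) (restrict-single x y w ox oy)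

  restrict-two-singles : ∀ (x y : Fin n) w → x ≢ y → occ x w ≡ 1 → occ y w ≡ 1 →
    ∃₂ λ p q → p ≢ q × restrict x y w ≡ p ∷ q ∷ []
  restrict-two-singles x y []      _   () _
  restrict-two-singles x y (z ∷ w) x≢y ox oy with x ≟ z | y ≟ z
  ... | yes refl | yes refl = ⊥-elim (x≢y refl)
  ... | yes refl | no _     = x , y , x≢y , (begin
    restrict x y (x ∷ w)  ≡⟨ restrict-∷-accept w (inj₁ refl) ⟩
    x ∷ restrict x y w    ≡⟨ cong (x ∷_) (restrict-comm x y w) ⟩
    x ∷ restrict y x w    ≡⟨ cong (x ∷_) (restrict-single y x w oy (suc-injective ox)) ⟩
    x ∷ y ∷ []            ∎)
  ... | no _     | yes refl = y , x , x≢y ∘ sym , (begin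
    restrict x y (y ∷ w)  ≡⟨ restrict-∷-accept w (inj₂ refl) ⟩
    y ∷ restrict x y w    ≡⟨ cong (y ∷_) (restrict-single x y w ox (suc-injective oy)) ⟩
    y ∷ x ∷ []            ∎)
  ... | no x≢z   | no y≢z
    with p , q , p≢q , eq ← restrict-two-singles x y w x≢y ox oy
    = p , q , p≢q , trans (restrict-∷-reject w x≢z y≢z) eq

  countSq-∷-∷ : ∀ (a b c : Fin n) w → ¬ (a ≡ b × a ≡ c) →
                countSq a (b ∷ c ∷ w) ≡ countSq a (c ∷ w)
  countSq-∷-∷ a b c w ¬aa with a ≟ b | a ≟ c
  ... | yes a≡b | yes a≡c = ⊥-elim (¬aa (a≡b , a≡c))
  ... | yes _   | no _    = refl
  ... | no _    | yes _   = refl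
  ... | no _    | no _    = refl

  countSq-∷-cong : ∀ (a b c : Fin n) v w → countSq a (c ∷ v) ≡ countSq a (c ∷ w) →
                   countSq a (b ∷ c ∷ v) ≡ countSq a (b ∷ c ∷ w)
  countSq-∷-cong a b c v w eq with a ≟ b | a ≟ c
  ... | yes _ | yes _ = cong suc eq
  ... | yes _ | no _  = eq
  ... | no _  | yes _ = eq
  ... | no _  | no _  = eq

  countSq-delete-return : ∀ (a : Fin n) u p q v → p ≢ q →
    countSq a (u ++ p ∷ q ∷ p ∷ v) ≡ countSq a (u ++ p ∷ v)
  countSq-delete-return a []          p q v p≢q = begin
    countSq a (p ∷ q ∷ p ∷ v)  ≡⟨ countSq-∷-∷ a p q (p ∷ v) (λ (a≡p , a≡q) → a≡p⇒a≢q a≡p a≡q) ⟩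
    countSq a (q ∷ p ∷ v)      ≡⟨ countSq-∷-∷ a q p v (λ (a≡q , a≡p) → a≡p⇒a≢q a≡p a≡q) ⟩
    countSq a (p ∷ v)          ∎
    where
    a≡p⇒a≢q : a ≡ p → a ≢ q
    a≡p⇒a≢q a≡p a≡q = p≢q (trans (sym a≡p) a≡q)
  countSq-delete-return a (b ∷ [])    p q v p≢q =
    countSq-∷-cong a b p (q ∷ p ∷ v) v (countSq-delete-return a [] p q v p≢q)
  countSq-delete-return a (b ∷ c ∷ u) p q v p≢q =
    countSq-∷-cong a b c _ _ (countSq-delete-return a (c ∷ u) p q v p≢q)

  countSq-restrict-delete-perm : ∀ (a x y : Fin n) u P v → x ≢ y → IsPerm P →
    countSq a (restrict x y (u ++ P ++ P ++ v)) ≡ countSq a (restrict x y (u ++ P ++ v))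
  countSq-restrict-delete-perm a x y u P v x≢y perm
    with p , q , p≢q , rP ← restrict-two-singles x y P x≢y (perm x) (perm y) = begin
      countSq a (r (u ++ P ++ P ++ v))       ≡⟨ cong (countSq a) (split3 u P P v) ⟩
      countSq a (r u ++ r P ++ r P ++ r v)   ≡⟨ cong (λ s → countSq a (r u ++ s ++ s ++ r v)) rP ⟩
      countSq a (r u ++ p ∷ q ∷ p ∷ q ∷ r v) ≡⟨ countSq-delete-return a (r u) p q (q ∷ r v) p≢q ⟩
      countSq a (r u ++ p ∷ q ∷ r v)         ≡⟨ cong (λ s → countSq a (r u ++ s ++ r v)) rP ⟨
      countSq a (r u ++ r P ++ r v)          ≡⟨ cong (countSq a) (split2 u P v) ⟨
      countSq a (r (u ++ P ++ v))            ∎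
    where
    r : Word n → Word n
    r = restrict x y

    split2 : ∀ u P v → r (u ++ P ++ v) ≡ r u ++ r P ++ r v
    split2 u P v = trans (restrict-++ x y u (P ++ v)) (cong (r u ++_) (restrict-++ x y P v))

    split3 : ∀ u P Q v → r (u ++ P ++ Q ++ v) ≡ r u ++ r P ++ r Q ++ r v
    split3 u P Q v = trans (split2 u P (Q ++ v)) (cong (λ s → r u ++ r P ++ s) (restrict-++ x y Q v))

  squareCount-delete-perm : ∀ (x y : Fin n) u P v → x ≢ y → IsPerm P →
    squareCount x y (u ++ P ++ P ++ v) ≡ squareCount x y (u ++ P ++ v)
  squareCount-delete-perm x y u P v x≢y perm =
    cong₂ _+_ (countSq-restrict-delete-perm x x y u P v x≢y perm)
              (countSq-restrict-delete-perm y x y u P v x≢y perm)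

  NonEmpty-delete : ∀ (u P v : Word n) → NonEmpty (u ++ P ++ P ++ v) → NonEmpty (u ++ P ++ v)
  NonEmpty-delete (_ ∷ _) _       _ _  = tt
  NonEmpty-delete []      (_ ∷ _) _ _  = tt
  NonEmpty-delete []      []      _ ne = ne

  Is1-11-Rep-delete-perm : ∀ (G : Graph n) u P v → IsPerm P →
    Is1-11-Rep G (u ++ P ++ P ++ v) → Is1-11-Rep G (u ++ P ++ v)
  Is1-11-Rep-delete-perm G u P v perm (ne , rep) = NonEmpty-delete u P v ne , λ x y x≢y →
    let count≡ = squareCount-delete-perm x y u P v x≢y perm
        adj⇔   = rep x y x≢y
    in mk⇔ (subst (_≤ 1) count≡ ∘ Equivalence.to adj⇔)
           (Equivalence.from adj⇔ ∘ subst (_≤ 1) (sym count≡))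

mainTheorem3 : ∀ {n : ℕ} (G : Graph n) (A B : List (Word n)) (P : Word n) →
    All IsPerm A → IsPerm P → All IsPerm B →
    Is1-11-Rep G (concat (A ++ P ∷ P ∷ B)) →
    Is1-11-Rep G (concat (A ++ P ∷ B))
-- Only the repeated block needs to be a permutation; the other blocks are arbitrary.
mainTheorem3 G A B P _ perm _ rep =
  subst (Is1-11-Rep G) (concat-++ A (P ∷ B))
    (Is1-11-Rep-delete-perm G (concat A) P (concat B) perm
      (subst (Is1-11-Rep G) (sym (concat-++ A (P ∷ P ∷ B))) rep))
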